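{- Let $n\ge 5$ and let $\mathcal{U}$ be an irreducible tight affine vector space partition of $\mathrm{PG}(n-1,2)$ of type $(n-2)^{m_{n-2}}\cdots 2^{m_2}$ (i.e. all elements have dimension between $2$ and $n-2$, and $m_i$ of them have dimension $i$). Then $m_{n-2}\le 2$.
   Context: $\mathrm{PG}(n-1,q)$ denotes the projective geometry of $\mathbb{F}_q^n$; all dimensions are algebraic (vector space) dimensions, so points are $1$-dimensional subspaces and hyperplanes are $(n-1)$-dimensional subspaces. An affine vector space partition (avsp) of $\mathrm{PG}(n-1,q)$ is a set $\mathcal{U}=\{U_1,\dots,U_r\}$ of subspaces with $1\le \dim U_i\le n-1$ for which there exists a hyperplane $H_\infty$ such that no $U_i$ is contained in $H_\infty$ and every point not contained in $H_\infty$ is contained in exactly one $U_i$. For a subspace $W\not\le H_\infty$, a set of subspaces of $W$ none of which lies in $H_\infty$ is an avsp of $W$ if every point of $W$ outside $H_\infty$ lies in exactly one of them. $\mathcal{U}$ is reducible if there exist a subspace $W$ with $\dim W<n$ and a subset $S\subsetneq\{1,\dots,r\}$ with $|S|>1$ such that $\{U_i: i\in S\}$ is an avsp of $W$; otherwise it is irreducible. $\mathcal{U}$ is tight if $U_1\cap\cdots\cap U_r$ is the zero subspace. -}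

module Defs where

open import Data.Bool using (Bool; true; false; _xor_; if_then_else_)
open import Data.Nat using (ℕ; zero; suc; _≤_; _<_; _∸_)
open import Data.Nat.Properties using (_≟_)
open import Data.Fin using (Fin)
open import Data.List using (List; length; filter)
open import Data.Vec using (Vec; []; _∷_; replicate; zipWith)
open import Data.Product using (Σ; ∃; _×_; _,_)
open import Relation.Binary.PropositionalEquality using (_≡_)
open import Relation.Nullary using (¬_)
open import Data.List using (allFin)

-- Vectors of F_2^n (F_2 = Bool with xor as addition, ∧ as multiplication)
V : ℕ → Set
V n = Vec Bool n

0V : ∀ {n} → V n
0V {n} = replicate n false

_⊕_ : ∀ {n} → V n → V n → V n
_⊕_ = zipWith _xor_

-- A subspace of F_2^n, given by its (decidable) membership predicate.
-- (Over F_2, closure under addition and containing 0 is exactly being a subspace.)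
record Subspace (n : ℕ) : Set where
  field
    mem     : V n → Bool
    memZero : mem 0V ≡ true
    memAdd  : ∀ u v → mem u ≡ true → mem v ≡ true → mem (u ⊕ v) ≡ true
open Subspace public

_∈_ : ∀ {n} → V n → Subspace n → Set
v ∈ U = mem U v ≡ true

_∉_ : ∀ {n} → V n → Subspace n → Set
v ∉ U = ¬ (v ∈ U)

_⊆_ : ∀ {n} → Subspace n → Subspace n → Set
U ⊆ W = ∀ v → v ∈ U → v ∈ W

lincomb : ∀ {n d} → Vec Bool d → Vec (V n) d → V n
lincomb []       []       = 0V
lincomb (c ∷ cs) (b ∷ bs) = if c then b ⊕ lincomb cs bs else lincomb cs bs

LinIndep : ∀ {n d} → Vec (V n) d → Set
LinIndep {n} {d} b = ∀ c → lincomb c b ≡ 0V → c ≡ replicate d false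

Spans : ∀ {n d} → Vec (V n) d → Subspace n → Set
Spans {n} {d} b U = ∀ v → (v ∈ U → Σ (Vec Bool d) λ c → lincomb c b ≡ v)
                          × ((c : Vec Bool d) → lincomb c b ∈ U)

HasDim : ∀ {n} → Subspace n → ℕ → Set
HasDim {n} U d = Σ (Vec (V n) d) λ b → LinIndep b × Spans b U

IsHyperplane : ∀ {n} → Subspace n → Set
IsHyperplane {n} H = HasDim H (n ∸ 1)

-- A point (1-dim subspace ⟨v⟩, v ≠ 0) lies in U iff v ∈ U.
-- "p lies in exactly one U_i for i in S" (S : Fin r → Bool selects a subfamily)
ExactlyOneIn : ∀ {n r} → (Fin r → Bool) → (Fin r → Subspace n) → V n → Set
ExactlyOneIn {r = r} S U p =
  Σ (Fin r) λ i → S i ≡ true × p ∈ U i × (∀ j → S j ≡ true → p ∈ U j → j ≡ i)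

allIdx : ∀ {r} → Fin r → Bool
allIdx _ = true

-- U_1..U_r is an affine vector space partition of PG(n-1,2) w.r.t. H∞ = H.
-- (Points outside H are exactly the vectors outside H; they are nonzero since 0 ∈ H.)
IsAVSP : ∀ {n r} → (Fin r → Subspace n) → Subspace n → Set
IsAVSP {n} {r} U H =
    IsHyperplane H
  × (∀ i → Σ ℕ λ k → 1 ≤ k × k ≤ n ∸ 1 × HasDim (U i) k)
  × (∀ i → ¬ (U i ⊆ H))
  × (∀ p → p ∉ H → ExactlyOneIn allIdx U p)

IsSubAVSPOf : ∀ {n r} → (Fin r → Bool) → (Fin r → Subspace n) → Subspace n → Subspace n → Set
IsSubAVSPOf S U W H =
    ¬ (W ⊆ H)
  × (∀ i → S i ≡ true → U i ⊆ W)
  × (∀ i → S i ≡ true → ¬ (U i ⊆ H))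
  × (∀ p → p ∈ W → p ∉ H → ExactlyOneIn S U p)

Reducible : ∀ {n r} → (Fin r → Subspace n) → Subspace n → Set
Reducible {n} {r} U H =
  Σ (Subspace n) λ W → Σ (Fin r → Bool) λ S →
      (Σ ℕ λ k → k < n × HasDim W k)
    × (Σ (Fin r) λ i → S i ≡ false)
    × (Σ (Fin r) λ i → Σ (Fin r) λ j → ¬ (i ≡ j) × S i ≡ true × S j ≡ true)
    × IsSubAVSPOf S U W H

Irreducible : ∀ {n r} → (Fin r → Subspace n) → Subspace n → Set
Irreducible U H = ¬ Reducible U H

Tight : ∀ {n r} → (Fin r → Subspace n) → Set
Tight {n} {r} U = ∀ v → (∀ i → v ∈ U i) → v ≡ 0V

mult : ∀ {r} → (Fin r → ℕ) → ℕ → ℕ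
mult {r} d k = length (filter (λ i → d i ≟ k) (allFin r))

-- Write n = 5 + m and let U₁, U₂, U₃ be three elements of dimension n − 2, with traces
-- Tᵢ = Uᵢ ∩ H∞ of dimension n − 3 and points aᵢ ∈ Uᵢ ∖ H∞.  If Tⱼ ⊆ Tᵢ, then Uᵢ and Uⱼ
-- partition the affine points of the hyperplane Uᵢ + ⟨aⱼ⟩, so irreducibility makes the
-- traces pairwise incomparable.  Since a₁ + a₂ avoids T₁ + T₂, this sum is a subspace E of
-- dimension n − 2, and Q = E + ⟨a₁⟩ is a hyperplane containing U₁ and missing U₂ ∖ H∞.
-- Modulo T₁ (resp. T₂) all points of U₃ ∖ H∞ inside Q (resp. outside Q) agree, so if U₃ ∖ H∞
-- lay on one side of Q then T₃ ⊆ T₁ or T₃ ⊆ T₂.  Otherwise K = T₃ ∩ E lies in T₁ ∩ T₂ ∩ T₃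
-- and has dimension n − 4.  The 2^(n−3) affine points outside U₁ ∪ U₂ ∪ U₃ are then exactly
-- the affine points of an (n − 2)-space W ⊇ K, so the remaining elements form an avsp of W;
-- by irreducibility each of them contains W, hence K ≠ 0 lies in every element, against
-- tightness.

module Submission where

open import Defs
open import Data.Nat using (ℕ; zero; suc; _+_; _*_; _^_; _≤_; _<_; _∸_; z≤n; s≤s; _≤?_) renaming (_≟_ to _≟ℕ_)
open import Data.Nat.Properties hiding (_≟_)
open import Data.Nat.Tactic.RingSolver using (solve-∀)
open import Algebra.Properties.CommutativeSemigroup +-commutativeSemigroup using () renaming (interchange to +-interchange)
open import Data.Bool using (Bool; true; false; _xor_; if_then_else_; _∧_; _∨_; not)
open import Data.Bool.Properties
  using (xor-comm; xor-assoc; xor-identityˡ; xor-identityʳ; xor-same;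
         ∧-conicalˡ; ∧-conicalʳ; ∧-zeroʳ; ∧-identityʳ; not-injective; ¬-not; not-¬)
open import Data.Fin using (Fin)
open import Data.Fin.Properties using (_≟_)
open import Data.Vec using (Vec; []; _∷_; zipWith)
open import Data.Vec.Properties using (zipWith-comm; zipWith-assoc; zipWith-identityˡ; zipWith-identityʳ)
open import Data.List using (List; []; _∷_; length; filter; allFin)
open import Data.List.Relation.Unary.Any using (here; there)
open import Data.List.Relation.Unary.All using (All) renaming (_∷_ to _∷ᵃ_)
open import Data.List.Relation.Unary.All.Properties using (all-filter)
open import Data.List.Relation.Unary.AllPairs using () renaming (_∷_ to _∷ᵖ_)
open import Data.List.Relation.Unary.Unique.Propositional using (Unique)
open import Data.List.Relation.Unary.Unique.Propositional.Properties using (allFin⁺; filter⁺)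
open import Data.List.Membership.Propositional using () renaming (_∈_ to _∈ˡ_)
import Data.List.Membership.DecPropositional as DecMembership
open import Data.Product using (Σ; _×_; _,_; proj₁; proj₂)
open import Data.Sum using (_⊎_; inj₁; inj₂; [_,_]′)
open import Data.Empty using (⊥; ⊥-elim)
open import Function using (_∘_)
open import Relation.Binary.PropositionalEquality
open import Relation.Nullary using (¬_; Dec; yes; no; does)
open import Relation.Nullary.Decidable using (dec-true; dec-false)

∨-introˡ : ∀ {a} b → a ≡ true → (a ∨ b) ≡ true
∨-introˡ b refl = refl

∨-introʳ : ∀ a {b} → b ≡ true → (a ∨ b) ≡ true
∨-introʳ true  e = refl
∨-introʳ false e = e

∨-elim : ∀ a b → (a ∨ b) ≡ true → (a ≡ true) ⊎ (b ≡ true)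
∨-elim true  b e = inj₁ refl
∨-elim false b e = inj₂ e

⇔⇒≡ : ∀ {a b} → (a ≡ true → b ≡ true) → (b ≡ true → a ≡ true) → a ≡ b
⇔⇒≡ {false} {false} _ _ = refl
⇔⇒≡ {false} {true}  _ g = g refl
⇔⇒≡ {true}  {false} f _ = sym (f refl)
⇔⇒≡ {true}  {true}  _ _ = refl

∧-intro : ∀ {a b} → a ≡ true → b ≡ true → (a ∧ b) ≡ true
∧-intro refl refl = refl

does⇒ : ∀ {A : Set} (a? : Dec A) → does a? ≡ true → A
does⇒ (yes a) _ = a

-- Vectors over F₂

⊕-comm : ∀ {n} (u v : V n) → u ⊕ v ≡ v ⊕ u
⊕-comm = zipWith-comm xor-comm

⊕-assoc : ∀ {n} (u v w : V n) → (u ⊕ v) ⊕ w ≡ u ⊕ (v ⊕ w)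
⊕-assoc = zipWith-assoc xor-assoc

⊕-identityˡ : ∀ {n} (u : V n) → 0V ⊕ u ≡ u
⊕-identityˡ = zipWith-identityˡ xor-identityˡ

⊕-identityʳ : ∀ {n} (u : V n) → u ⊕ 0V ≡ u
⊕-identityʳ = zipWith-identityʳ xor-identityʳ

⊕-self : ∀ {n} (u : V n) → u ⊕ u ≡ 0V
⊕-self []      = refl
⊕-self (x ∷ u) = cong₂ _∷_ (xor-same x) (⊕-self u)

⊕-cancelˡ : ∀ {n} (a u : V n) → a ⊕ (a ⊕ u) ≡ u
⊕-cancelˡ a u = begin
  a ⊕ (a ⊕ u) ≡⟨ ⊕-assoc a a u ⟨
  (a ⊕ a) ⊕ u ≡⟨ cong (_⊕ u) (⊕-self a) ⟩
  0V ⊕ u      ≡⟨ ⊕-identityˡ u ⟩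
  u           ∎
  where open ≡-Reasoning

⊕-cancelʳ : ∀ {n} (u a : V n) → (u ⊕ a) ⊕ a ≡ u
⊕-cancelʳ u a = begin
  (u ⊕ a) ⊕ a ≡⟨ ⊕-assoc u a a ⟩
  u ⊕ (a ⊕ a) ≡⟨ cong (u ⊕_) (⊕-self a) ⟩
  u ⊕ 0V      ≡⟨ ⊕-identityʳ u ⟩
  u           ∎
  where open ≡-Reasoning

⊕-cancel-outer : ∀ {n} (u a : V n) → (a ⊕ u) ⊕ a ≡ u
⊕-cancel-outer u a = trans (cong (_⊕ a) (⊕-comm a u)) (⊕-cancelʳ u a)

⊕-leftComm : ∀ {n} (x y z : V n) → x ⊕ (y ⊕ z) ≡ y ⊕ (x ⊕ z)
⊕-leftComm x y z = begin
  x ⊕ (y ⊕ z) ≡⟨ ⊕-assoc x y z ⟨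
  (x ⊕ y) ⊕ z ≡⟨ cong (_⊕ z) (⊕-comm x y) ⟩
  (y ⊕ x) ⊕ z ≡⟨ ⊕-assoc y x z ⟩
  y ⊕ (x ⊕ z) ∎
  where open ≡-Reasoning

⊕-cancel-commonˡ : ∀ {n} (a x y : V n) → (a ⊕ x) ⊕ (a ⊕ y) ≡ x ⊕ y
⊕-cancel-commonˡ a x y = begin
  (a ⊕ x) ⊕ (a ⊕ y) ≡⟨ ⊕-assoc a x (a ⊕ y) ⟩
  a ⊕ (x ⊕ (a ⊕ y)) ≡⟨ cong (a ⊕_) (⊕-leftComm x a y) ⟩
  a ⊕ (a ⊕ (x ⊕ y)) ≡⟨ ⊕-cancelˡ a (x ⊕ y) ⟩
  x ⊕ y             ∎
  where open ≡-Reasoning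

⊕-cancel-commonʳ : ∀ {n} (x y a : V n) → (x ⊕ a) ⊕ (y ⊕ a) ≡ x ⊕ y
⊕-cancel-commonʳ x y a = trans (cong₂ _⊕_ (⊕-comm x a) (⊕-comm y a)) (⊕-cancel-commonˡ a x y)

⊕≡0V⇒≡ : ∀ {n} (u v : V n) → u ⊕ v ≡ 0V → u ≡ v
⊕≡0V⇒≡ u v e = trans (sym (⊕-cancelʳ u v)) (trans (cong (_⊕ v) e) (⊕-identityˡ v))

-- Counting vectors

Pred : ℕ → Set
Pred n = V n → Bool

_⊆ᵇ_ : ∀ {n} → Pred n → Pred n → Set
P ⊆ᵇ Q = ∀ v → P v ≡ true → Q v ≡ true

isZero : ∀ {n} → Pred n
isZero []      = true
isZero (x ∷ v) = not x ∧ isZero v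

isZero⇒≡0V : ∀ {n} (v : V n) → isZero v ≡ true → v ≡ 0V
isZero⇒≡0V []          e = refl
isZero⇒≡0V (false ∷ v) e = cong (false ∷_) (isZero⇒≡0V v e)

isZero-0V : ∀ n → isZero (0V {n}) ≡ true
isZero-0V zero    = refl
isZero-0V (suc n) = isZero-0V n

opaque
  count : ∀ {n} → Pred n → ℕ
  count {zero}  P = if P [] then 1 else 0
  count {suc n} P = count (λ v → P (false ∷ v)) + count (λ v → P (true ∷ v))

  count-cong : ∀ {n} (P Q : Pred n) → (∀ v → P v ≡ Q v) → count P ≡ count Q
  count-cong {zero}  P Q e rewrite e [] = refl
  count-cong {suc n} P Q e =
    cong₂ _+_ (count-cong _ _ (λ v → e (false ∷ v))) (count-cong _ _ (λ v → e (true ∷ v)))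

  count-mono : ∀ {n} (P Q : Pred n) → P ⊆ᵇ Q → count P ≤ count Q
  count-mono {zero} P Q P⊆Q with P [] in eq
  ... | false = z≤n
  ... | true  rewrite P⊆Q [] eq = ≤-refl
  count-mono {suc n} P Q P⊆Q =
    +-mono-≤ (count-mono _ _ (λ v → P⊆Q (false ∷ v))) (count-mono _ _ (λ v → P⊆Q (true ∷ v)))

  count-∨-disjoint : ∀ {n} (P Q : Pred n) → (∀ v → P v ≡ true → Q v ≡ false) →
    count (λ v → P v ∨ Q v) ≡ count P + count Q
  count-∨-disjoint {zero} P Q disj with P [] in eq
  ... | false = refl
  ... | true  rewrite disj [] eq = refl
  count-∨-disjoint {suc n} P Q disj =
    trans (cong₂ _+_ (count-∨-disjoint _ _ (λ v → disj (false ∷ v))) (count-∨-disjoint _ _ (λ v → disj (true ∷ v))))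
          (+-interchange (count (λ v → P (false ∷ v))) _ _ _)

  count-⊕-invariant : ∀ {n} (P : Pred n) (a : V n) → count (λ v → P (v ⊕ a)) ≡ count P
  count-⊕-invariant {zero}  P []          = refl
  count-⊕-invariant {suc n} P (false ∷ a) =
    cong₂ _+_ (count-⊕-invariant (λ v → P (false ∷ v)) a) (count-⊕-invariant (λ v → P (true ∷ v)) a)
  count-⊕-invariant {suc n} P (true ∷ a)  =
    trans (cong₂ _+_ (count-⊕-invariant (λ v → P (true ∷ v)) a) (count-⊕-invariant (λ v → P (false ∷ v)) a))
          (+-comm (count (λ v → P (true ∷ v))) (count (λ v → P (false ∷ v))))

  count-all : ∀ n → count {n} (λ _ → true) ≡ 2 ^ n
  count-all zero    = refl
  count-all (suc n) = trans (cong₂ _+_ (count-all n) (count-all n)) (cong (2 ^ n +_) (sym (+-identityʳ (2 ^ n))))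

  count-isZero : ∀ n → count {n} isZero ≡ 1
  count-isZero zero    = refl
  count-isZero (suc n) = trans (cong (_+ count {n} (λ _ → false)) (count-isZero n)) (cong suc (count-none n))
    where
    count-none : ∀ n → count {n} (λ _ → false) ≡ 0
    count-none zero    = refl
    count-none (suc n) = cong₂ _+_ (count-none n) (count-none n)

  count≡0⇒false : ∀ {n} (P : Pred n) → count P ≡ 0 → ∀ v → P v ≡ false
  count≡0⇒false {zero} P e [] with P []
  ... | false = refl
  count≡0⇒false {suc n} P e (false ∷ v) = count≡0⇒false _ (m+n≡0⇒m≡0 _ e) v
  count≡0⇒false {suc n} P e (true ∷ v)  = count≡0⇒false _ (m+n≡0⇒n≡0 (count (λ v → P (false ∷ v))) e) v

  count>0⇒witness : ∀ {n} (P : Pred n) → 0 < count P → Σ (V n) λ v → P v ≡ true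
  count>0⇒witness {zero} P pos with P [] in eq
  ... | true = [] , eq
  count>0⇒witness {suc n} P pos with count (λ v → P (false ∷ v)) in eq
  ... | zero  = let (v , e) = count>0⇒witness (λ v → P (true ∷ v)) pos in true ∷ v , e
  ... | suc _ = let (v , e) = count>0⇒witness (λ v → P (false ∷ v)) (subst (0 <_) (sym eq) (s≤s z≤n)) in false ∷ v , e

witness⇒count>0 : ∀ {n} (P : Pred n) v → P v ≡ true → 0 < count P
witness⇒count>0 P v Pv with count P in eq
... | suc _ = s≤s z≤n
... | zero  with () ← trans (sym Pv) (count≡0⇒false P eq v)

count-∨-translate : ∀ {n} (P : Pred n) (a : V n) → (∀ v → P v ≡ true → P (v ⊕ a) ≡ false) →
  count (λ v → P v ∨ P (v ⊕ a)) ≡ count P + count P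
count-∨-translate P a disj = trans (count-∨-disjoint P (λ v → P (v ⊕ a)) disj) (cong (count P +_) (count-⊕-invariant P a))

count-split : ∀ {n} (P Q : Pred n) → count P ≡ count (λ v → P v ∧ Q v) + count (λ v → P v ∧ not (Q v))
count-split P Q = trans (count-cong P _ by-cases) (count-∨-disjoint (λ v → P v ∧ Q v) (λ v → P v ∧ not (Q v)) disjoint)
  where
  by-cases : ∀ v → P v ≡ ((P v ∧ Q v) ∨ (P v ∧ not (Q v)))
  by-cases v with P v | Q v
  ... | true  | true  = refl
  ... | true  | false = refl
  ... | false | _     = refl
  disjoint : ∀ v → (P v ∧ Q v) ≡ true → (P v ∧ not (Q v)) ≡ false
  disjoint v e with P v | Q v
  ... | true  | true  = refl
  ... | false | _     = refl

count-split-⊆ : ∀ {n} (P Q : Pred n) → Q ⊆ᵇ P → count P ≡ count Q + count (λ v → P v ∧ not (Q v))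
count-split-⊆ P Q Q⊆P = trans (count-split P Q) (cong (_+ count (λ v → P v ∧ not (Q v))) (count-cong _ _ P∧Q≡Q))
  where
  P∧Q≡Q : ∀ v → (P v ∧ Q v) ≡ Q v
  P∧Q≡Q v = ⇔⇒≡ (∧-conicalʳ _ _) (λ Qv → ∧-intro (Q⊆P v Qv) Qv)

count-<⇒witness : ∀ {n} (P Q : Pred n) → count P < count Q → Σ (V n) λ v → Q v ≡ true × P v ≡ false
count-<⇒witness P Q P<Q with count (λ v → Q v ∧ not (P v)) in eq
... | suc _ = let (v , e) = count>0⇒witness (λ v → Q v ∧ not (P v)) (subst (0 <_) (sym eq) (s≤s z≤n))
              in v , ∧-conicalˡ (Q v) _ e , not-injective (∧-conicalʳ (Q v) _ e)
... | zero  = ⊥-elim (<⇒≱ P<Q (begin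
  count Q                                                   ≡⟨ count-split Q P ⟩
  count (λ v → Q v ∧ P v) + count (λ v → Q v ∧ not (P v))   ≡⟨ cong (count (λ v → Q v ∧ P v) +_) eq ⟩
  count (λ v → Q v ∧ P v) + 0                               ≡⟨ +-identityʳ _ ⟩
  count (λ v → Q v ∧ P v)                                   ≤⟨ count-mono _ P (λ v → ∧-conicalʳ (Q v) (P v)) ⟩
  count P                                                   ∎))
  where open ≤-Reasoning

count-≥⇒⊇ : ∀ {n} (P Q : Pred n) → P ⊆ᵇ Q → count Q ≤ count P → Q ⊆ᵇ P
count-≥⇒⊇ P Q P⊆Q Q≤P v Qv = ¬-not λ Pv≡false →
  <⇒≱ (subst (count P <_) (sym (count-split-⊆ Q P P⊆Q))
         (m<m+n (count P) (witness⇒count>0 _ v (cong₂ (λ a b → a ∧ not b) Qv Pv≡false))))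
      Q≤P

⊆ᵇ-or-witness : ∀ {n} (P Q : Pred n) → (P ⊆ᵇ Q) ⊎ (Σ (V n) λ v → P v ≡ true × Q v ≡ false)
⊆ᵇ-or-witness P Q with count (λ v → P v ∧ not (Q v)) in eq
... | zero  = inj₁ λ v Pv → not-injective (subst (λ b → b ∧ not (Q v) ≡ false) Pv (count≡0⇒false _ eq v))
... | suc _ = let (v , e) = count>0⇒witness (λ v → P v ∧ not (Q v)) (subst (0 <_) (sym eq) (s≤s z≤n))
              in inj₂ (v , ∧-conicalˡ (P v) _ e , not-injective (∧-conicalʳ (P v) _ e))

-- Dimension as a count

span : ∀ {n d} → Vec (V n) d → Pred n
span []       v = isZero v
span (b ∷ bs) v = span bs v ∨ span bs (v ⊕ b)

span-lincomb : ∀ {n d} (bs : Vec (V n) d) (c : Vec Bool d) → span bs (lincomb c bs) ≡ true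
span-lincomb {n} []       []          = isZero-0V n
span-lincomb     (b ∷ bs) (false ∷ c) = ∨-introˡ _ (span-lincomb bs c)
span-lincomb     (b ∷ bs) (true ∷ c)  =
  ∨-introʳ (span bs (b ⊕ lincomb c bs))
    (subst (λ w → span bs w ≡ true) (sym (⊕-cancel-outer (lincomb c bs) b)) (span-lincomb bs c))

span⇒lincomb : ∀ {n d} (bs : Vec (V n) d) (v : V n) → span bs v ≡ true → Σ (Vec Bool d) λ c → lincomb c bs ≡ v
span⇒lincomb []       v e = [] , sym (isZero⇒≡0V v e)
span⇒lincomb (b ∷ bs) v e with span bs v in eq
... | true  = let (c , c≡) = span⇒lincomb bs v eq in false ∷ c , c≡
... | false = let (c , c≡) = span⇒lincomb bs (v ⊕ b) e
              in true ∷ c , trans (cong (b ⊕_) c≡) (trans (⊕-comm b (v ⊕ b)) (⊕-cancelʳ v b))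

lincomb-⊕ : ∀ {n d} (c c′ : Vec Bool d) (bs : Vec (V n) d) →
  lincomb (zipWith _xor_ c c′) bs ≡ lincomb c bs ⊕ lincomb c′ bs
lincomb-⊕ []          []           []       = sym (⊕-self 0V)
lincomb-⊕ (false ∷ c) (false ∷ c′) (b ∷ bs) = lincomb-⊕ c c′ bs
lincomb-⊕ (true ∷ c)  (false ∷ c′) (b ∷ bs) = trans (cong (b ⊕_) (lincomb-⊕ c c′ bs)) (sym (⊕-assoc b _ _))
lincomb-⊕ (false ∷ c) (true ∷ c′)  (b ∷ bs) = trans (cong (b ⊕_) (lincomb-⊕ c c′ bs)) (⊕-leftComm b _ _)
lincomb-⊕ (true ∷ c)  (true ∷ c′)  (b ∷ bs) = trans (lincomb-⊕ c c′ bs) (sym (⊕-cancel-commonˡ b _ _))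

span-⊕ : ∀ {n d} (bs : Vec (V n) d) (u v : V n) → span bs u ≡ true → span bs v ≡ true → span bs (u ⊕ v) ≡ true
span-⊕ bs u v u∈ v∈ =
  let (c , c≡) = span⇒lincomb bs u u∈ ; (c′ , c′≡) = span⇒lincomb bs v v∈
  in subst (λ w → span bs w ≡ true) (trans (lincomb-⊕ c c′ bs) (cong₂ _⊕_ c≡ c′≡)) (span-lincomb bs (zipWith _xor_ c c′))

LinIndep-tail : ∀ {n d} (b : V n) (bs : Vec (V n) d) → LinIndep (b ∷ bs) → LinIndep bs
LinIndep-tail b bs indep c e = cong Data.Vec.tail (indep (false ∷ c) e)

LinIndep-head∉span : ∀ {n d} (b : V n) (bs : Vec (V n) d) → LinIndep (b ∷ bs) → span bs b ≡ false
LinIndep-head∉span b bs indep with span bs b in eq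
... | false = refl
... | true  with span⇒lincomb bs b eq
... | c , c≡ with () ← indep (true ∷ c) (trans (cong (b ⊕_) c≡) (⊕-self b))

count-span : ∀ {n d} (bs : Vec (V n) d) → LinIndep bs → count (span bs) ≡ 2 ^ d
count-span {n} []                 indep = count-isZero n
count-span {n} {suc d} (b ∷ bs) indep = begin
  count (span (b ∷ bs))               ≡⟨ count-∨-translate (span bs) b disjoint ⟩
  count (span bs) + count (span bs)   ≡⟨ cong₂ _+_ ih ih ⟩
  2 ^ d + 2 ^ d                       ≡⟨ cong (2 ^ d +_) (+-identityʳ (2 ^ d)) ⟨
  2 ^ suc d                           ∎
  where
  open ≡-Reasoning
  ih = count-span bs (LinIndep-tail b bs indep)
  disjoint : ∀ v → span bs v ≡ true → span bs (v ⊕ b) ≡ false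
  disjoint v v∈ with span bs (v ⊕ b) in eq
  ... | false = refl
  ... | true  with () ← trans (sym (subst (λ w → span bs w ≡ true) (⊕-cancelˡ v b) (span-⊕ bs v (v ⊕ b) v∈ eq)))
                              (LinIndep-head∉span b bs indep)

Spans⇒mem≡span : ∀ {n d} (U : Subspace n) (bs : Vec (V n) d) → Spans bs U → ∀ v → mem U v ≡ span bs v
Spans⇒mem≡span U bs spans v = ⇔⇒≡
  (λ v∈U → let (c , c≡) = proj₁ (spans v) v∈U in subst (λ w → span bs w ≡ true) c≡ (span-lincomb bs c))
  (λ v∈bs → let (c , c≡) = span⇒lincomb bs v v∈bs in subst (_∈ U) c≡ (proj₂ (spans v) c))

HasDim⇒count : ∀ {n d} (U : Subspace n) → HasDim U d → count (mem U) ≡ 2 ^ d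
HasDim⇒count U (bs , indep , spans) = trans (count-cong _ _ (Spans⇒mem≡span U bs spans)) (count-span bs indep)

LinIndep-∷ : ∀ {n d} (x : V n) (bs : Vec (V n) d) → span bs x ≡ false → LinIndep bs → LinIndep (x ∷ bs)
LinIndep-∷ x bs x∉ indep (false ∷ c) e = cong (false ∷_) (indep c e)
LinIndep-∷ x bs x∉ indep (true ∷ c)  e
  with () ← trans (sym x∉) (subst (λ w → span bs w ≡ true) (⊕≡0V⇒≡ _ x (trans (⊕-comm _ x) e)) (span-lincomb bs c))

span-∷-⊆ : ∀ {n d} (X : Subspace n) (x : V n) (bs : Vec (V n) d) → x ∈ X → span bs ⊆ᵇ mem X → span (x ∷ bs) ⊆ᵇ mem X
span-∷-⊆ X x bs x∈X bs⊆X v v∈ with ∨-elim _ _ v∈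
... | inj₁ e = bs⊆X v e
... | inj₂ e = subst (_∈ X) (⊕-cancelʳ v x) (memAdd X (v ⊕ x) x (bs⊆X (v ⊕ x) e) x∈X)

count⇒HasDim : ∀ {n} (X : Subspace n) (k : ℕ) → count (mem X) ≡ 2 ^ k → HasDim X k
count⇒HasDim {n} X k count≡ = extend k [] refl (λ { [] _ → refl }) (λ v e → subst (_∈ X) (sym (isZero⇒≡0V v e)) (memZero X))
  where
  extend : (t : ℕ) → ∀ {j} (bs : Vec (V n) j) → j + t ≡ k → LinIndep bs → span bs ⊆ᵇ mem X → HasDim X k
  extend zero {j} bs j+0≡k indep bs⊆X rewrite sym j+0≡k | +-identityʳ j = bs , indep , spans
    where
    X⊆bs : mem X ⊆ᵇ span bs
    X⊆bs = count-≥⇒⊇ (span bs) (mem X) bs⊆X (≤-reflexive (trans count≡ (sym (count-span bs indep))))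
    spans : Spans bs X
    spans v = (λ e → span⇒lincomb bs v (X⊆bs v e)) , (λ c → bs⊆X _ (span-lincomb bs c))
  extend (suc t) {j} bs j+t≡k indep bs⊆X =
    extend t (x ∷ bs) (trans (sym (+-suc j t)) j+t≡k) (LinIndep-∷ x bs x∉bs indep) (span-∷-⊆ X x bs x∈X bs⊆X)
    where
    bs<X : count (span bs) < count (mem X)
    bs<X = subst₂ _<_ (sym (count-span bs indep)) (sym count≡)
             (^-monoʳ-< 2 (s≤s (s≤s z≤n)) (subst (j <_) j+t≡k (m<m+n j (s≤s z≤n))))
    new = count-<⇒witness (span bs) (mem X) bs<X
    x = proj₁ new
    x∈X = proj₁ (proj₂ new)
    x∉bs = proj₂ (proj₂ new)

-- Subspaces

mem-⊕ʳ : ∀ {n} (U : Subspace n) (v x : V n) → x ∈ U → mem U (v ⊕ x) ≡ mem U v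
mem-⊕ʳ U v x x∈U with mem U v in eq
... | true  = memAdd U v x eq x∈U
... | false with mem U (v ⊕ x) in eq′
... | false = refl
... | true  with () ← trans (sym (subst (λ w → w ∈ U) (⊕-cancelʳ v x) (memAdd U (v ⊕ x) x eq′ x∈U))) eq

mem-⊕ˡ : ∀ {n} (U : Subspace n) (x v : V n) → x ∈ U → mem U (x ⊕ v) ≡ mem U v
mem-⊕ˡ U x v x∈U = trans (cong (mem U) (⊕-comm x v)) (mem-⊕ʳ U v x x∈U)

_∩ˢ_ : ∀ {n} → Subspace n → Subspace n → Subspace n
U ∩ˢ W = record
  { mem     = λ v → mem U v ∧ mem W v
  ; memZero = ∧-intro (memZero U) (memZero W)
  ; memAdd  = λ u v u∈ v∈ → ∧-intro (memAdd U u v (∧-conicalˡ _ _ u∈) (∧-conicalˡ _ _ v∈))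
                                    (memAdd W u v (∧-conicalʳ _ _ u∈) (∧-conicalʳ _ _ v∈))
  }

_+⟨_⟩ : ∀ {n} → Subspace n → V n → Subspace n
S +⟨ a ⟩ = record
  { mem     = λ v → mem S v ∨ mem S (v ⊕ a)
  ; memZero = ∨-introˡ _ (memZero S)
  ; memAdd  = add
  }
  where
  add : ∀ u v → (mem S u ∨ mem S (u ⊕ a)) ≡ true → (mem S v ∨ mem S (v ⊕ a)) ≡ true →
        (mem S (u ⊕ v) ∨ mem S ((u ⊕ v) ⊕ a)) ≡ true
  add u v u∈ v∈ with ∨-elim _ _ u∈ | ∨-elim _ _ v∈
  ... | inj₁ x | inj₁ y = ∨-introˡ _ (memAdd S u v x y)
  ... | inj₁ x | inj₂ y = ∨-introʳ _ (subst (_∈ S) (sym (⊕-assoc u v a)) (memAdd S u (v ⊕ a) x y))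
  ... | inj₂ x | inj₁ y = ∨-introʳ _ (subst (_∈ S) (trans (⊕-assoc u a v) (trans (cong (u ⊕_) (⊕-comm a v)) (sym (⊕-assoc u v a))))
                                                (memAdd S (u ⊕ a) v x y))
  ... | inj₂ x | inj₂ y = ∨-introˡ _ (subst (_∈ S) (⊕-cancel-commonʳ u v a) (memAdd S (u ⊕ a) (v ⊕ a) x y))

module _ {n} (S : Subspace n) (a : V n) where

  +⟨⟩-base : S ⊆ (S +⟨ a ⟩)
  +⟨⟩-base v = ∨-introˡ _

  +⟨⟩-new : a ∈ (S +⟨ a ⟩)
  +⟨⟩-new = ∨-introʳ (mem S a) (subst (_∈ S) (sym (⊕-self a)) (memZero S))

  +⟨⟩-elim : ∀ v → v ∈ (S +⟨ a ⟩) → (v ∈ S) ⊎ ((v ⊕ a) ∈ S)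
  +⟨⟩-elim v = ∨-elim _ _

  +⟨⟩-least : ∀ (Y : Subspace n) → S ⊆ Y → a ∈ Y → (S +⟨ a ⟩) ⊆ Y
  +⟨⟩-least Y S⊆Y a∈Y v v∈ with +⟨⟩-elim v v∈
  ... | inj₁ e = S⊆Y v e
  ... | inj₂ e = subst (_∈ Y) (⊕-cancelʳ v a) (memAdd Y (v ⊕ a) a (S⊆Y (v ⊕ a) e) a∈Y)

  count-+⟨⟩ : mem S a ≡ false → count (mem (S +⟨ a ⟩)) ≡ count (mem S) + count (mem S)
  count-+⟨⟩ a∉S = count-∨-translate (mem S) a (λ v v∈S → trans (mem-⊕ˡ S v a v∈S) a∉S)

outside-⊆⇒⊆ : ∀ {n} (X Y H : Subspace n) (b : V n) → b ∈ X → mem H b ≡ false →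
  (∀ y → y ∈ X → mem H y ≡ false → y ∈ Y) → X ⊆ Y
outside-⊆⇒⊆ X Y H b b∈X b∉H outside⊆Y x x∈X with mem H x in eq
... | false = outside⊆Y x x∈X eq
... | true  = subst (_∈ Y) (⊕-cancelˡ b x)
                (memAdd Y b (b ⊕ x) (outside⊆Y b b∈X b∉H)
                  (outside⊆Y (b ⊕ x) (memAdd X b x b∈X x∈X) (trans (mem-⊕ʳ H b x eq) b∉H)))

a≡2^k⇒a+a≡2^1+k : ∀ a k → a ≡ 2 ^ k → a + a ≡ 2 ^ suc k
a≡2^k⇒a+a≡2^1+k a k refl = cong (2 ^ k +_) (sym (+-identityʳ (2 ^ k)))

a+a≡2^1+k⇒a≡2^k : ∀ a k → a + a ≡ 2 ^ suc k → a ≡ 2 ^ k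
a+a≡2^1+k⇒a≡2^k a k e = *-cancelˡ-≡ a (2 ^ k) 2 (trans (cong (a +_) (+-identityʳ a)) e)

count-+⟨⟩-2^ : ∀ {n} k (S : Subspace n) (a : V n) → mem S a ≡ false → count (mem S) ≡ 2 ^ k →
  count (mem (S +⟨ a ⟩)) ≡ 2 ^ suc k
count-+⟨⟩-2^ k S a a∉S S≡ = trans (count-+⟨⟩ S a a∉S) (a≡2^k⇒a+a≡2^1+k _ k S≡)

coset-sum : ∀ {n} (T E : Subspace n) → T ⊆ E → count (mem E) ≤ count (mem T) + count (mem T) →
  ∀ x y → x ∈ E → y ∈ E → mem T x ≡ false → mem T y ≡ false → (x ⊕ y) ∈ T
coset-sum T E T⊆E E≤ x y x∈E y∈E x∉T y∉T =
  [ (λ y∈T → ⊥-elim (not-¬ y∉T y∈T)) , subst (_∈ T) (⊕-comm y x) ]′ (+⟨⟩-elim T x y (E⊆T+x y y∈E))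
  where
  E⊆T+x : E ⊆ (T +⟨ x ⟩)
  E⊆T+x = count-≥⇒⊇ (mem (T +⟨ x ⟩)) (mem E) (+⟨⟩-least T x E T⊆E x∈E)
            (subst (count (mem E) ≤_) (sym (count-+⟨⟩ T x x∉T)) E≤)

⊤ˢ : ∀ {n} → Subspace n
⊤ˢ = record { mem = λ _ → true ; memZero = refl ; memAdd = λ _ _ _ _ → refl }

IndexTwo : ∀ {n} → Subspace n → Set
IndexTwo Y = ∀ x y → mem Y x ≡ false → mem Y y ≡ false → (x ⊕ y) ∈ Y

count⇒IndexTwo : ∀ {n} k (Y : Subspace n) → count (mem Y) ≡ 2 ^ k → suc k ≡ n → IndexTwo Y
count⇒IndexTwo {n} k Y Y≡ refl x y =
  coset-sum Y ⊤ˢ (λ _ _ → refl) (≤-reflexive (trans (count-all n) (sym (a≡2^k⇒a+a≡2^1+k _ k Y≡)))) x y refl refl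

module _ {n} (Y : Subspace n) (Y-index : IndexTwo Y) where

  mem-⊕-outside : ∀ v x → mem Y x ≡ false → mem Y (v ⊕ x) ≡ not (mem Y v)
  mem-⊕-outside v x x∉Y with mem Y v in eq
  ... | false = Y-index v x eq x∉Y
  ... | true  = trans (mem-⊕ˡ Y v x eq) x∉Y

  module _ (X : Subspace n) (x : V n) (x∈X : x ∈ X) (x∉Y : mem Y x ≡ false) where

    count-outside≡count-inside : count (λ v → mem X v ∧ not (mem Y v)) ≡ count (λ v → mem X v ∧ mem Y v)
    count-outside≡count-inside = trans (count-cong _ _ translate) (count-⊕-invariant (λ v → mem X v ∧ mem Y v) x)
      where
      translate : ∀ v → (mem X v ∧ not (mem Y v)) ≡ (mem X (v ⊕ x) ∧ mem Y (v ⊕ x))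
      translate v rewrite mem-⊕ʳ X v x x∈X | mem-⊕-outside v x x∉Y = refl

    count-halves : ∀ k → count (mem X) ≡ 2 ^ suc k → count (λ v → mem X v ∧ mem Y v) ≡ 2 ^ k
    count-halves k X≡ = a+a≡2^1+k⇒a≡2^k _ k (begin
      count (λ v → mem X v ∧ mem Y v) + count (λ v → mem X v ∧ mem Y v)
        ≡⟨ cong (count (λ v → mem X v ∧ mem Y v) +_) count-outside≡count-inside ⟨
      count (λ v → mem X v ∧ mem Y v) + count (λ v → mem X v ∧ not (mem Y v))
        ≡⟨ count-split (mem X) (mem Y) ⟨
      count (mem X)
        ≡⟨ X≡ ⟩
      2 ^ suc k ∎)
      where open ≡-Reasoning

-- Affine vector space partitions

module Partition {n r} (U : Fin r → Subspace n) (H : Subspace n) (H-index : IndexTwo H)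
  (U⊈H : ∀ i → ¬ (U i ⊆ H)) (partition : ∀ p → p ∉ H → ExactlyOneIn allIdx U p) where

  open DecMembership (_≟_ {r}) public using (_∈?_)

  selects : List (Fin r) → Fin r → Bool
  selects is x = does (x ∈? is)

  point-outside : ∀ i → Σ (V n) λ v → v ∈ U i × mem H v ≡ false
  point-outside i with ⊆ᵇ-or-witness (mem (U i)) (mem H)
  ... | inj₁ U⊆H = ⊥-elim (U⊈H i U⊆H)
  ... | inj₂ w   = w

  index-unique : ∀ {i j p} → mem H p ≡ false → p ∈ U i → p ∈ U j → i ≡ j
  index-unique {i} {j} {p} p∉H p∈Ui p∈Uj with partition p (not-¬ p∉H)
  ... | _ , _ , _ , unique = trans (unique i refl p∈Ui) (sym (unique j refl p∈Uj))

  trace : Fin r → Subspace n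
  trace i = U i ∩ˢ H

  count-trace : ∀ i k → count (mem (U i)) ≡ 2 ^ suc k → count (mem (trace i)) ≡ 2 ^ k
  count-trace i = let (a , a∈U , a∉H) = point-outside i in count-halves H H-index (U i) a a∈U a∉H

  sub-avsp : (S : Fin r → Bool) (W : Subspace n) (b : V n) → b ∈ W → mem H b ≡ false →
    (∀ i → S i ≡ true → U i ⊆ W) → (∀ p → p ∈ W → mem H p ≡ false → ∀ i → p ∈ U i → S i ≡ true) →
    IsSubAVSPOf S U W H
  sub-avsp S W b b∈W b∉H U⊆W selected = (λ W⊆H → not-¬ b∉H (W⊆H b b∈W)) , U⊆W , (λ i _ → U⊈H i) , exactly-one
    where
    exactly-one : ∀ p → p ∈ W → p ∉ H → ExactlyOneIn S U p
    exactly-one p p∈W p∉H with partition p p∉H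
    ... | i , _ , p∈Ui , unique = i , selected p p∈W (¬-not p∉H) i p∈Ui , p∈Ui , λ j _ → unique j refl

  count-outside : ∀ i k → count (mem (U i)) ≡ 2 ^ suc k → count (λ v → mem (U i) v ∧ not (mem H v)) ≡ 2 ^ k
  count-outside i k Ui≡ =
    let (a , a∈U , a∉H) = point-outside i
    in trans (count-outside≡count-inside H H-index (U i) a a∈U a∉H) (count-trace i k Ui≡)

  outside-all : List (Fin r) → Pred n
  outside-all []       v = not (mem H v)
  outside-all (i ∷ is) v = outside-all is v ∧ not (mem (U i) v)

  outside-all⇒∉H : ∀ is p → outside-all is p ≡ true → mem H p ≡ false
  outside-all⇒∉H []       p e = not-injective e
  outside-all⇒∉H (i ∷ is) p e = outside-all⇒∉H is p (∧-conicalˡ _ _ e)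

  outside-all⇒∉ : ∀ is p → outside-all is p ≡ true → ∀ x → p ∈ U x → ¬ (x ∈ˡ is)
  outside-all⇒∉ (i ∷ is) p e x p∈Ux (here refl) = not-¬ p∈Ux (not-injective (∧-conicalʳ _ _ e))
  outside-all⇒∉ (i ∷ is) p e x p∈Ux (there x∈is) = outside-all⇒∉ is p (∧-conicalˡ _ _ e) x p∈Ux x∈is

  outside-all-intro : ∀ is p → mem H p ≡ false → ∀ x → p ∈ U x → ¬ (x ∈ˡ is) → outside-all is p ≡ true
  outside-all-intro []       p p∉H x p∈Ux x∉is = cong not p∉H
  outside-all-intro (i ∷ is) p p∉H x p∈Ux x∉is =
    ∧-intro (outside-all-intro is p p∉H x p∈Ux (x∉is ∘ there))
            (cong not (¬-not λ p∈Ui → x∉is (here (index-unique p∉H p∈Ux p∈Ui))))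

  outside-all-⊕ : ∀ is r κ → κ ∈ H → (∀ i → i ∈ˡ is → κ ∈ U i) → outside-all is (r ⊕ κ) ≡ outside-all is r
  outside-all-⊕ []       r κ κ∈H κ∈U = cong not (mem-⊕ʳ H r κ κ∈H)
  outside-all-⊕ (i ∷ is) r κ κ∈H κ∈U =
    cong₂ (λ a b → a ∧ not b) (outside-all-⊕ is r κ κ∈H (λ j → κ∈U j ∘ there)) (mem-⊕ʳ (U i) r κ (κ∈U i (here refl)))

  count-outside-all-∷ : ∀ i is → ¬ (i ∈ˡ is) →
    count (outside-all is) ≡ count (λ v → mem (U i) v ∧ not (mem H v)) + count (outside-all (i ∷ is))
  count-outside-all-∷ i is i∉is =
    trans (count-split (outside-all is) (mem (U i))) (cong (_+ count (outside-all (i ∷ is))) (count-cong _ _ pointwise))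
    where
    pointwise : ∀ v → (outside-all is v ∧ mem (U i) v) ≡ (mem (U i) v ∧ not (mem H v))
    pointwise v with mem (U i) v in v∈Ui | mem H v in v∈H
    ... | false | _     = ∧-zeroʳ _
    ... | true  | false = trans (∧-identityʳ _) (outside-all-intro is v v∈H i v∈Ui i∉is)
    ... | true  | true  = trans (∧-identityʳ _) (¬-not λ e → not-¬ (outside-all⇒∉H is v e) v∈H)

  equal-traces⇒sub-avsp : ∀ {i j} a → a ∈ U j → mem H a ≡ false → trace i ⊆ trace j → trace j ⊆ trace i →
    IsSubAVSPOf (selects (i ∷ j ∷ [])) U (U i +⟨ a ⟩) H
  equal-traces⇒sub-avsp {i} {j} a a∈Uj a∉H Ti⊆Tj Tj⊆Ti = sub-avsp S W a (+⟨⟩-new (U i) a) a∉H U⊆W selected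
    where
    W = U i +⟨ a ⟩
    S = selects (i ∷ j ∷ [])
    Uj⊆W : U j ⊆ W
    Uj⊆W = outside-⊆⇒⊆ (U j) W H a a∈Uj a∉H λ y y∈Uj y∉H →
      ∨-introʳ (mem (U i) y) (∧-conicalˡ _ _ (Tj⊆Ti (y ⊕ a) (∧-intro (memAdd (U j) y a y∈Uj a∈Uj) (H-index y a y∉H a∉H))))
    U⊆W : ∀ x → S x ≡ true → U x ⊆ W
    U⊆W x Sx with does⇒ (x ∈? (i ∷ j ∷ [])) Sx
    ... | here refl         = +⟨⟩-base (U i) a
    ... | there (here refl) = Uj⊆W
    selected : ∀ p → p ∈ W → mem H p ≡ false → ∀ x → p ∈ U x → S x ≡ true
    selected p p∈W p∉H x p∈Ux with +⟨⟩-elim (U i) a p p∈W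
    ... | inj₁ p∈Ui   = dec-true (x ∈? (i ∷ j ∷ [])) (here (index-unique p∉H p∈Ux p∈Ui))
    ... | inj₂ p⊕a∈Ui = dec-true (x ∈? (i ∷ j ∷ [])) (there (here (index-unique p∉H p∈Ux p∈Uj)))
      where
      p∈Uj : p ∈ U j
      p∈Uj = subst (_∈ U j) (⊕-cancelʳ p a)
               (memAdd (U j) (p ⊕ a) a (∧-conicalˡ _ _ (Ti⊆Tj (p ⊕ a) (∧-intro p⊕a∈Ui (H-index p a p∉H a∉H)))) a∈Uj)

  module _ (irreducible : Irreducible U H) where

    proper-sub-avsp⇒⊆ : (S : Fin r → Bool) (W : Subspace n) → (Σ ℕ λ k → k < n × HasDim W k) →
      (Σ (Fin r) λ l → S l ≡ false) → IsSubAVSPOf S U W H → ∀ i → S i ≡ true → W ⊆ U i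
    proper-sub-avsp⇒⊆ S W dimW unselected sub@(_ , U⊆W , _ , exactly-one) i Si =
      outside-⊆⇒⊆ W (U i) H b (U⊆W i Si b b∈Ui) b∉H only-i
      where
      b = proj₁ (point-outside i)
      b∈Ui = proj₁ (proj₂ (point-outside i))
      b∉H = proj₂ (proj₂ (point-outside i))
      only-i : ∀ y → y ∈ W → mem H y ≡ false → y ∈ U i
      only-i y y∈W y∉H with exactly-one y y∈W (not-¬ y∉H)
      ... | j , Sj , y∈Uj , _ with i ≟ j
      ... | yes refl = y∈Uj
      ... | no i≢j   = ⊥-elim (irreducible (W , S , dimW , unselected , (i , j , i≢j , Si , Sj) , sub))

    trace-⊈ : ∀ {i j l} k → ¬ (i ≡ j) → ¬ (l ≡ i) → ¬ (l ≡ j) → suc (suc k) < n →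
      count (mem (U i)) ≡ 2 ^ suc k → count (mem (U j)) ≡ 2 ^ suc k → ¬ (trace j ⊆ trace i)
    trace-⊈ {i} {j} {l} k i≢j l≢i l≢j dim< Ui≡ Uj≡ Tj⊆Ti =
      irreducible (U i +⟨ a ⟩ , selects (i ∷ j ∷ []) , (suc (suc k) , dim< , count⇒HasDim (U i +⟨ a ⟩) _ W≡) ,
                   (l , Sl) , (i , j , i≢j , Si , Sj) , equal-traces⇒sub-avsp a a∈Uj a∉H Ti⊆Tj Tj⊆Ti)
      where
      Ti⊆Tj : trace i ⊆ trace j
      Ti⊆Tj = count-≥⇒⊇ (mem (trace j)) (mem (trace i)) Tj⊆Ti
                (≤-reflexive (trans (count-trace i k Ui≡) (sym (count-trace j k Uj≡))))
      a = proj₁ (point-outside j)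
      a∈Uj = proj₁ (proj₂ (point-outside j))
      a∉H = proj₂ (proj₂ (point-outside j))
      W≡ : count (mem (U i +⟨ a ⟩)) ≡ 2 ^ suc (suc k)
      W≡ = count-+⟨⟩-2^ (suc k) (U i) a (¬-not λ a∈Ui → i≢j (index-unique a∉H a∈Ui a∈Uj)) Ui≡
      Si : selects (i ∷ j ∷ []) i ≡ true
      Si = dec-true (i ∈? (i ∷ j ∷ [])) (here refl)
      Sj : selects (i ∷ j ∷ []) j ≡ true
      Sj = dec-true (j ∈? (i ∷ j ∷ [])) (there (here refl))
      Sl : selects (i ∷ j ∷ []) l ≡ false
      Sl = dec-false (l ∈? (i ∷ j ∷ [])) λ { (here l≡i) → l≢i l≡i ; (there (here l≡j)) → l≢j l≡j }

-- Three elements of dimension n − 2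

module CodimTwoTriple (m r : ℕ) (U : Fin r → Subspace (5 + m)) (H : Subspace (5 + m))
  (H≡ : count (mem H) ≡ 2 ^ (4 + m))
  (U⊈H : ∀ i → ¬ (U i ⊆ H)) (partition : ∀ p → p ∉ H → ExactlyOneIn allIdx U p)
  (irreducible : Irreducible U H) (tight : Tight U)
  {i₁ i₂ i₃ : Fin r} (i₁≢i₂ : ¬ (i₁ ≡ i₂)) (i₁≢i₃ : ¬ (i₁ ≡ i₃)) (i₂≢i₃ : ¬ (i₂ ≡ i₃))
  (U₁≡ : count (mem (U i₁)) ≡ 2 ^ (3 + m)) (U₂≡ : count (mem (U i₂)) ≡ 2 ^ (3 + m))
  (U₃≡ : count (mem (U i₃)) ≡ 2 ^ (3 + m)) where

  H-index : IndexTwo H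
  H-index = count⇒IndexTwo (4 + m) H H≡ refl

  open Partition U H H-index U⊈H partition

  T₁ T₂ T₃ : Subspace (5 + m)
  T₁ = trace i₁
  T₂ = trace i₂
  T₃ = trace i₃

  T₁≡ : count (mem T₁) ≡ 2 ^ (2 + m)
  T₁≡ = count-trace i₁ (2 + m) U₁≡
  T₂≡ : count (mem T₂) ≡ 2 ^ (2 + m)
  T₂≡ = count-trace i₂ (2 + m) U₂≡
  T₃≡ : count (mem T₃) ≡ 2 ^ (2 + m)
  T₃≡ = count-trace i₃ (2 + m) U₃≡

  T₂⊈T₁ : ¬ (T₂ ⊆ T₁)
  T₂⊈T₁ = trace-⊈ irreducible (2 + m) i₁≢i₂ (i₁≢i₃ ∘ sym) (i₂≢i₃ ∘ sym) (n<1+n (4 + m)) U₁≡ U₂≡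
  T₃⊈T₁ : ¬ (T₃ ⊆ T₁)
  T₃⊈T₁ = trace-⊈ irreducible (2 + m) i₁≢i₃ (i₁≢i₂ ∘ sym) i₂≢i₃ (n<1+n (4 + m)) U₁≡ U₃≡
  T₃⊈T₂ : ¬ (T₃ ⊆ T₂)
  T₃⊈T₂ = trace-⊈ irreducible (2 + m) i₂≢i₃ i₁≢i₂ i₁≢i₃ (n<1+n (4 + m)) U₂≡ U₃≡

  a₁ a₂ a₃ : V (5 + m)
  a₁ = proj₁ (point-outside i₁)
  a₂ = proj₁ (point-outside i₂)
  a₃ = proj₁ (point-outside i₃)
  a₁∈U₁ : a₁ ∈ U i₁
  a₁∈U₁ = proj₁ (proj₂ (point-outside i₁))
  a₂∈U₂ : a₂ ∈ U i₂
  a₂∈U₂ = proj₁ (proj₂ (point-outside i₂))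
  a₃∈U₃ : a₃ ∈ U i₃
  a₃∈U₃ = proj₁ (proj₂ (point-outside i₃))
  a₁∉H : mem H a₁ ≡ false
  a₁∉H = proj₂ (proj₂ (point-outside i₁))
  a₂∉H : mem H a₂ ≡ false
  a₂∉H = proj₂ (proj₂ (point-outside i₂))
  a₃∉H : mem H a₃ ≡ false
  a₃∉H = proj₂ (proj₂ (point-outside i₃))

  three : List (Fin r)
  three = i₁ ∷ i₂ ∷ i₃ ∷ []

  count-outside-H : count (λ v → not (mem H v)) ≡ 2 ^ (4 + m)
  count-outside-H = +-cancelˡ-≡ (count (mem H)) _ _ (begin
    count (mem H) + count (λ v → not (mem H v)) ≡⟨ count-split (λ _ → true) (mem H) ⟨
    count (λ _ → true)                          ≡⟨ count-all (5 + m) ⟩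
    2 ^ (5 + m)                                 ≡⟨ a≡2^k⇒a+a≡2^1+k _ (4 + m) refl ⟨
    2 ^ (4 + m) + 2 ^ (4 + m)                   ≡⟨ cong (_+ 2 ^ (4 + m)) H≡ ⟨
    count (mem H) + 2 ^ (4 + m)                 ∎)
    where open ≡-Reasoning

  count-outside-three : count (outside-all three) ≡ 2 ^ (2 + m)
  count-outside-three = three-quarters _ _ (begin
    x + (x + (x + count (outside-all three)))     ≡⟨ cong (λ y → x + (x + y)) (peel i₁ (i₂ ∷ i₃ ∷ []) i₁∉ U₁≡) ⟩
    x + (x + count (outside-all (i₂ ∷ i₃ ∷ [])))  ≡⟨ cong (x +_) (peel i₂ (i₃ ∷ []) i₂∉ U₂≡) ⟩
    x + count (outside-all (i₃ ∷ []))             ≡⟨ peel i₃ [] (λ ()) U₃≡ ⟩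
    count (outside-all [])                        ≡⟨ count-outside-H ⟩
    2 ^ (4 + m)                                   ∎)
    where
    open ≡-Reasoning
    x = 2 ^ (2 + m)
    peel : ∀ i is → ¬ (i ∈ˡ is) → count (mem (U i)) ≡ 2 ^ (3 + m) →
      x + count (outside-all (i ∷ is)) ≡ count (outside-all is)
    peel i is i∉is Ui≡ =
      trans (cong (_+ count (outside-all (i ∷ is))) (sym (count-outside i (2 + m) Ui≡))) (sym (count-outside-all-∷ i is i∉is))
    i₁∉ : ¬ (i₁ ∈ˡ (i₂ ∷ i₃ ∷ []))
    i₁∉ (here e)         = i₁≢i₂ e
    i₁∉ (there (here e)) = i₁≢i₃ e
    i₂∉ : ¬ (i₂ ∈ˡ (i₃ ∷ []))
    i₂∉ (here e) = i₂≢i₃ e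
    three-quarters : ∀ x y → x + (x + (x + y)) ≡ 2 * (2 * x) → y ≡ x
    three-quarters x y e = +-cancelˡ-≡ x y x (+-cancelˡ-≡ x _ _ (+-cancelˡ-≡ x _ _ (trans e (sym (four x)))))
      where
      four : ∀ x → x + (x + (x + x)) ≡ 2 * (2 * x)
      four = solve-∀

  c : V (5 + m)
  c = a₁ ⊕ a₂

  c∈H : c ∈ H
  c∈H = H-index a₁ a₂ a₁∉H a₂∉H

  c⊕T₂-avoids-T₁ : ∀ s → s ∈ T₂ → mem T₁ (c ⊕ s) ≡ false
  c⊕T₂-avoids-T₁ s s∈T₂ = ¬-not λ c⊕s∈T₁ → i₁≢i₂ (index-unique a₂⊕s∉H (a₂⊕s∈U₁ c⊕s∈T₁) a₂⊕s∈U₂)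
    where
    a₂⊕s∉H : mem H (a₂ ⊕ s) ≡ false
    a₂⊕s∉H = trans (mem-⊕ʳ H a₂ s (∧-conicalʳ _ _ s∈T₂)) a₂∉H
    a₂⊕s∈U₂ : (a₂ ⊕ s) ∈ U i₂
    a₂⊕s∈U₂ = memAdd (U i₂) a₂ s a₂∈U₂ (∧-conicalˡ _ _ s∈T₂)
    a₂⊕s∈U₁ : (c ⊕ s) ∈ T₁ → (a₂ ⊕ s) ∈ U i₁
    a₂⊕s∈U₁ c⊕s∈T₁ = subst (_∈ U i₁) (trans (sym (⊕-assoc a₁ c s)) (cong (_⊕ s) (⊕-cancelˡ a₁ a₂)))
                       (memAdd (U i₁) a₁ (c ⊕ s) a₁∈U₁ (∧-conicalˡ _ _ c⊕s∈T₁))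

  traces-span : Σ (Subspace (5 + m)) λ E →
    count (mem E) ≡ 2 ^ (3 + m) × T₁ ⊆ E × T₂ ⊆ E × E ⊆ H × mem E c ≡ false
  traces-span with ⊆ᵇ-or-witness (mem T₂) (mem T₁)
  ... | inj₁ T₂⊆T₁ = ⊥-elim (T₂⊈T₁ T₂⊆T₁)
  ... | inj₂ (e , e∈T₂ , e∉T₁) = E , E≡ , +⟨⟩-base T₁ e , T₂⊆E , E⊆H , c∉E
    where
    E = T₁ +⟨ e ⟩
    E≡ : count (mem E) ≡ 2 ^ (3 + m)
    E≡ = count-+⟨⟩-2^ (2 + m) T₁ e e∉T₁ T₁≡
    E⊆H : E ⊆ H
    E⊆H = +⟨⟩-least T₁ e H (λ v → ∧-conicalʳ _ _) (∧-conicalʳ _ _ e∈T₂)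
    c⊕s∈E⇒⊥ : ∀ s → s ∈ T₂ → (c ⊕ s) ∈ E → ⊥
    c⊕s∈E⇒⊥ s s∈T₂ c⊕s∈E with +⟨⟩-elim T₁ e (c ⊕ s) c⊕s∈E
    ... | inj₁ c⊕s∈T₁   = not-¬ (c⊕T₂-avoids-T₁ s s∈T₂) c⊕s∈T₁
    ... | inj₂ c⊕s⊕e∈T₁ = not-¬ (c⊕T₂-avoids-T₁ (s ⊕ e) (memAdd T₂ s e s∈T₂ e∈T₂)) (subst (_∈ T₁) (⊕-assoc c s e) c⊕s⊕e∈T₁)
    c∉E : mem E c ≡ false
    c∉E = ¬-not λ c∈E → c⊕s∈E⇒⊥ 0V (memZero T₂) (subst (_∈ E) (sym (⊕-identityʳ c)) c∈E)
    T₂⊆E : T₂ ⊆ E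
    T₂⊆E t t∈T₂ = ¬-not λ t∉E → [ not-¬ c∉E , c⊕s∈E⇒⊥ t t∈T₂ ]′ (+⟨⟩-elim E t c (H⊆E+t t∉E c c∈H))
      where
      H⊆E+t : mem E t ≡ false → H ⊆ (E +⟨ t ⟩)
      H⊆E+t t∉E = count-≥⇒⊇ (mem (E +⟨ t ⟩)) (mem H) (+⟨⟩-least E t H E⊆H (∧-conicalʳ _ _ t∈T₂))
                    (≤-reflexive (trans H≡ (sym (count-+⟨⟩-2^ (3 + m) E t t∉E E≡))))

  module TraceSum (E : Subspace (5 + m)) (E≡ : count (mem E) ≡ 2 ^ (3 + m))
    (T₁⊆E : T₁ ⊆ E) (T₂⊆E : T₂ ⊆ E) (E⊆H : E ⊆ H) (c∉E : mem E c ≡ false) where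

    Q : Subspace (5 + m)
    Q = E +⟨ a₁ ⟩

    a₁∉E : mem E a₁ ≡ false
    a₁∉E = ¬-not λ a₁∈E → not-¬ a₁∉H (E⊆H a₁ a₁∈E)

    Q-index : IndexTwo Q
    Q-index = count⇒IndexTwo (4 + m) Q (count-+⟨⟩-2^ (3 + m) E a₁ a₁∉E E≡) refl

    E⊆Q : E ⊆ Q
    E⊆Q = +⟨⟩-base E a₁

    Q∩H⊆E : ∀ x → x ∈ Q → x ∈ H → x ∈ E
    Q∩H⊆E x x∈Q x∈H with +⟨⟩-elim E a₁ x x∈Q
    ... | inj₁ x∈E    = x∈E
    ... | inj₂ x⊕a₁∈E = ⊥-elim (not-¬ (trans (mem-⊕ˡ H x a₁ x∈H) a₁∉H) (E⊆H _ x⊕a₁∈E))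

    U₁⊆Q : U i₁ ⊆ Q
    U₁⊆Q = outside-⊆⇒⊆ (U i₁) Q H a₁ a₁∈U₁ a₁∉H λ x x∈U₁ x∉H →
      ∨-introʳ (mem E x) (T₁⊆E (x ⊕ a₁) (∧-intro (memAdd (U i₁) x a₁ x∈U₁ a₁∈U₁) (H-index x a₁ x∉H a₁∉H)))

    U₂-outside-H-avoids-Q : ∀ x → x ∈ U i₂ → mem H x ≡ false → mem Q x ≡ false
    U₂-outside-H-avoids-Q x x∈U₂ x∉H = ¬-not λ x∈Q → not-¬ c∉E (c∈E x∈Q)
      where
      x⊕a₂∈E : (x ⊕ a₂) ∈ E
      x⊕a₂∈E = T₂⊆E (x ⊕ a₂) (∧-intro (memAdd (U i₂) x a₂ x∈U₂ a₂∈U₂) (H-index x a₂ x∉H a₂∉H))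
      c∈E : x ∈ Q → c ∈ E
      c∈E x∈Q with +⟨⟩-elim E a₁ x x∈Q
      ... | inj₁ x∈E    = ⊥-elim (not-¬ x∉H (E⊆H x x∈E))
      ... | inj₂ x⊕a₁∈E = subst (_∈ E) (⊕-cancel-commonˡ x a₁ a₂) (memAdd E (x ⊕ a₁) (x ⊕ a₂) x⊕a₁∈E x⊕a₂∈E)

    T-coset-sum : ∀ T → T ⊆ E → count (mem T) ≡ 2 ^ (2 + m) →
      ∀ x y → x ∈ E → y ∈ E → mem T x ≡ false → mem T y ≡ false → (x ⊕ y) ∈ T
    T-coset-sum T T⊆E T≡ = coset-sum T E T⊆E (≤-reflexive (trans E≡ (sym (a≡2^k⇒a+a≡2^1+k _ (2 + m) T≡))))

    inside-Q⇒⊕∈T₁ : ∀ x y → x ∈ Q → y ∈ Q → mem H x ≡ false → mem H y ≡ false →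
      mem (U i₁) x ≡ false → mem (U i₁) y ≡ false → (x ⊕ y) ∈ T₁
    inside-Q⇒⊕∈T₁ x y x∈Q y∈Q x∉H y∉H x∉U₁ y∉U₁ =
      subst (_∈ T₁) (⊕-cancel-commonʳ x y a₁)
        (T-coset-sum T₁ T₁⊆E T₁≡ (x ⊕ a₁) (y ⊕ a₁) (⊕a₁∈E x x∈Q x∉H) (⊕a₁∈E y y∈Q y∉H) (⊕a₁∉T₁ x x∉U₁) (⊕a₁∉T₁ y y∉U₁))
      where
      ⊕a₁∈E : ∀ z → z ∈ Q → mem H z ≡ false → (z ⊕ a₁) ∈ E
      ⊕a₁∈E z z∈Q z∉H with +⟨⟩-elim E a₁ z z∈Q
      ... | inj₁ z∈E    = ⊥-elim (not-¬ z∉H (E⊆H z z∈E))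
      ... | inj₂ z⊕a₁∈E = z⊕a₁∈E
      ⊕a₁∉T₁ : ∀ z → mem (U i₁) z ≡ false → mem T₁ (z ⊕ a₁) ≡ false
      ⊕a₁∉T₁ z z∉U₁ = cong (_∧ mem H (z ⊕ a₁)) (trans (mem-⊕ʳ (U i₁) z a₁ a₁∈U₁) z∉U₁)

    outside-Q⇒⊕∈T₂ : ∀ x y → mem Q x ≡ false → mem Q y ≡ false → mem H x ≡ false → mem H y ≡ false →
      mem (U i₂) x ≡ false → mem (U i₂) y ≡ false → (x ⊕ y) ∈ T₂
    outside-Q⇒⊕∈T₂ x y x∉Q y∉Q x∉H y∉H x∉U₂ y∉U₂ =
      subst (_∈ T₂) (⊕-cancel-commonʳ x y a₂)
        (T-coset-sum T₂ T₂⊆E T₂≡ (x ⊕ a₂) (y ⊕ a₂) (⊕a₂∈E x x∉Q x∉H) (⊕a₂∈E y y∉Q y∉H) (⊕a₂∉T₂ x x∉U₂) (⊕a₂∉T₂ y y∉U₂))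
      where
      a₂∉Q : mem Q a₂ ≡ false
      a₂∉Q = U₂-outside-H-avoids-Q a₂ a₂∈U₂ a₂∉H
      ⊕a₂∈E : ∀ z → mem Q z ≡ false → mem H z ≡ false → (z ⊕ a₂) ∈ E
      ⊕a₂∈E z z∉Q z∉H = Q∩H⊆E (z ⊕ a₂) (Q-index z a₂ z∉Q a₂∉Q) (H-index z a₂ z∉H a₂∉H)
      ⊕a₂∉T₂ : ∀ z → mem (U i₂) z ≡ false → mem T₂ (z ⊕ a₂) ≡ false
      ⊕a₂∉T₂ z z∉U₂ = cong (_∧ mem H (z ⊕ a₂)) (trans (mem-⊕ʳ (U i₂) z a₂ a₂∈U₂) z∉U₂)

    U₃-outside-H-avoids : ∀ {j} → ¬ (j ≡ i₃) → ∀ x → x ∈ U i₃ → mem H x ≡ false → mem (U j) x ≡ false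
    U₃-outside-H-avoids j≢i₃ x x∈U₃ x∉H = ¬-not λ x∈Uj → j≢i₃ (index-unique x∉H x∈Uj x∈U₃)

    shift-inside-Q⇒∈T₁ : ∀ q t → q ∈ U i₃ → mem H q ≡ false → q ∈ Q → t ∈ T₃ → (q ⊕ t) ∈ Q → t ∈ T₁
    shift-inside-Q⇒∈T₁ q t q∈U₃ q∉H q∈Q t∈T₃ q⊕t∈Q =
      subst (_∈ T₁) (⊕-cancel-outer t q) (inside-Q⇒⊕∈T₁ (q ⊕ t) q q⊕t∈Q q∈Q q⊕t∉H q∉H
        (U₃-outside-H-avoids i₁≢i₃ _ q⊕t∈U₃ q⊕t∉H) (U₃-outside-H-avoids i₁≢i₃ q q∈U₃ q∉H))
      where
      q⊕t∈U₃ = memAdd (U i₃) q t q∈U₃ (∧-conicalˡ _ _ t∈T₃)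
      q⊕t∉H = trans (mem-⊕ʳ H q t (∧-conicalʳ _ _ t∈T₃)) q∉H

    shift-outside-Q⇒∈T₂ : ∀ q t → q ∈ U i₃ → mem H q ≡ false → mem Q q ≡ false → t ∈ T₃ → mem Q (q ⊕ t) ≡ false → t ∈ T₂
    shift-outside-Q⇒∈T₂ q t q∈U₃ q∉H q∉Q t∈T₃ q⊕t∉Q =
      subst (_∈ T₂) (⊕-cancel-outer t q) (outside-Q⇒⊕∈T₂ (q ⊕ t) q q⊕t∉Q q∉Q q⊕t∉H q∉H
        (U₃-outside-H-avoids i₂≢i₃ _ q⊕t∈U₃ q⊕t∉H) (U₃-outside-H-avoids i₂≢i₃ q q∈U₃ q∉H))
      where
      q⊕t∈U₃ = memAdd (U i₃) q t q∈U₃ (∧-conicalˡ _ _ t∈T₃)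
      q⊕t∉H = trans (mem-⊕ʳ H q t (∧-conicalʳ _ _ t∈T₃)) q∉H

    A₃ : Pred (5 + m)
    A₃ v = mem (U i₃) v ∧ not (mem H v)

    A₃-shift : ∀ t → t ∈ T₃ → A₃ (a₃ ⊕ t) ≡ true
    A₃-shift t t∈T₃ =
      ∧-intro (memAdd (U i₃) a₃ t a₃∈U₃ (∧-conicalˡ _ _ t∈T₃)) (cong not (trans (mem-⊕ʳ H a₃ t (∧-conicalʳ _ _ t∈T₃)) a₃∉H))

    A₃⊆Q-impossible : ¬ (A₃ ⊆ᵇ mem Q)
    A₃⊆Q-impossible A₃⊆Q = T₃⊈T₁ λ t t∈T₃ →
      shift-inside-Q⇒∈T₁ a₃ t a₃∈U₃ a₃∉H (A₃⊆Q a₃ (∧-intro a₃∈U₃ (cong not a₃∉H))) t∈T₃ (A₃⊆Q _ (A₃-shift t t∈T₃))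

    A₃∩Q-empty-impossible : ¬ (A₃ ⊆ᵇ (not ∘ mem Q))
    A₃∩Q-empty-impossible A₃⊆∁Q = T₃⊈T₂ λ t t∈T₃ →
      shift-outside-Q⇒∈T₂ a₃ t a₃∈U₃ a₃∉H (not-injective (A₃⊆∁Q a₃ (∧-intro a₃∈U₃ (cong not a₃∉H)))) t∈T₃
        (not-injective (A₃⊆∁Q _ (A₃-shift t t∈T₃)))

    module Straddling (q q′ : V (5 + m)) (q∈U₃ : q ∈ U i₃) (q∉H : mem H q ≡ false) (q∈Q : q ∈ Q)
      (q′∈U₃ : q′ ∈ U i₃) (q′∉H : mem H q′ ≡ false) (q′∉Q : mem Q q′ ≡ false) where

      K : Subspace (5 + m)
      K = T₃ ∩ˢ E

      K⊆T₃ : K ⊆ T₃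
      K⊆T₃ t = ∧-conicalˡ _ _

      K⊆E : K ⊆ E
      K⊆E t = ∧-conicalʳ _ _

      K⊆H : K ⊆ H
      K⊆H t t∈K = E⊆H t (K⊆E t t∈K)

      K⊆T₁ : K ⊆ T₁
      K⊆T₁ t t∈K = shift-inside-Q⇒∈T₁ q t q∈U₃ q∉H q∈Q (K⊆T₃ t t∈K) (trans (mem-⊕ʳ Q q t (E⊆Q t (K⊆E t t∈K))) q∈Q)

      K⊆T₂ : K ⊆ T₂
      K⊆T₂ t t∈K = shift-outside-Q⇒∈T₂ q′ t q′∈U₃ q′∉H q′∉Q (K⊆T₃ t t∈K) (trans (mem-⊕ʳ Q q′ t (E⊆Q t (K⊆E t t∈K))) q′∉Q)

      -- q ⊕ q′ ∈ T₃ ∖ Q, so Q halves T₃; and on T₃ ⊆ H, membership in Q is membership in E.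
      K≡ : count (mem K) ≡ 2 ^ (1 + m)
      K≡ = trans (count-cong _ _ E≡Q-on-T₃) (count-halves Q Q-index T₃ (q ⊕ q′) q⊕q′∈T₃ q⊕q′∉Q (1 + m) T₃≡)
        where
        q⊕q′∈T₃ : (q ⊕ q′) ∈ T₃
        q⊕q′∈T₃ = ∧-intro (memAdd (U i₃) q q′ q∈U₃ q′∈U₃) (H-index q q′ q∉H q′∉H)
        q⊕q′∉Q : mem Q (q ⊕ q′) ≡ false
        q⊕q′∉Q = trans (mem-⊕ˡ Q q q′ q∈Q) q′∉Q
        E≡Q-on-T₃ : ∀ v → (mem T₃ v ∧ mem E v) ≡ (mem T₃ v ∧ mem Q v)
        E≡Q-on-T₃ v with mem T₃ v in v∈T₃
        ... | false = refl
        ... | true  = ⇔⇒≡ (E⊆Q v) (λ v∈Q → Q∩H⊆E v v∈Q (∧-conicalʳ _ _ v∈T₃))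

      R : Pred (5 + m)
      R = outside-all three

      R-intro : ∀ v → mem H v ≡ false → mem (U i₁) v ≡ false → mem (U i₂) v ≡ false → mem (U i₃) v ≡ false → R v ≡ true
      R-intro v v∉H v∉U₁ v∉U₂ v∉U₃ rewrite v∉H | v∉U₁ | v∉U₂ | v∉U₃ = refl

      K⊆U-three : ∀ κ → κ ∈ K → ∀ i → i ∈ˡ three → κ ∈ U i
      K⊆U-three κ κ∈K i (here refl)                 = ∧-conicalˡ _ _ (K⊆T₁ κ κ∈K)
      K⊆U-three κ κ∈K i (there (here refl))         = ∧-conicalˡ _ _ (K⊆T₂ κ κ∈K)
      K⊆U-three κ κ∈K i (there (there (here refl))) = ∧-conicalˡ _ _ (K⊆T₃ κ κ∈K)

      R-⊕K : ∀ r p → R r ≡ true → (p ⊕ r) ∈ K → R p ≡ true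
      R-⊕K r p r∈R p⊕r∈K = begin
        R p                 ≡⟨ cong R (trans (⊕-comm r (p ⊕ r)) (⊕-cancelʳ p r)) ⟨
        R (r ⊕ (p ⊕ r))     ≡⟨ outside-all-⊕ three r (p ⊕ r) (K⊆H _ p⊕r∈K) (K⊆U-three _ p⊕r∈K) ⟩
        R r                 ≡⟨ r∈R ⟩
        true                ∎
        where open ≡-Reasoning

      ⊕-out-of-K∉U₃ : ∀ p s → p ∈ U i₃ → s ∈ H → s ∈ E → mem K s ≡ false → mem (U i₃) (p ⊕ s) ≡ false
      ⊕-out-of-K∉U₃ p s p∈U₃ s∈H s∈E s∉K = ¬-not λ p⊕s∈U₃ →
        not-¬ s∉K (∧-intro (∧-intro (subst (_∈ U i₃) (⊕-cancelˡ p s) (memAdd (U i₃) p (p ⊕ s) p∈U₃ p⊕s∈U₃)) s∈H) s∈E)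

      point-outside-K : ∀ T → count (mem T) ≡ 2 ^ (2 + m) → Σ (V (5 + m)) λ s → s ∈ T × mem K s ≡ false
      point-outside-K T T≡ =
        count-<⇒witness (mem K) (mem T) (subst₂ _<_ (sym K≡) (sym T≡) (^-monoʳ-< 2 (s≤s (s≤s z≤n)) (n<1+n (1 + m))))

      s₀ s₁ : V (5 + m)
      s₀ = proj₁ (point-outside-K T₁ T₁≡)
      s₁ = proj₁ (point-outside-K T₂ T₂≡)
      s₀∈T₁ : s₀ ∈ T₁
      s₀∈T₁ = proj₁ (proj₂ (point-outside-K T₁ T₁≡))
      s₁∈T₂ : s₁ ∈ T₂
      s₁∈T₂ = proj₁ (proj₂ (point-outside-K T₂ T₂≡))
      s₀∉K : mem K s₀ ≡ false
      s₀∉K = proj₂ (proj₂ (point-outside-K T₁ T₁≡))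
      s₁∉K : mem K s₁ ≡ false
      s₁∉K = proj₂ (proj₂ (point-outside-K T₂ T₂≡))

      r₀ r₁ : V (5 + m)
      r₀ = q ⊕ s₀
      r₁ = q′ ⊕ s₁

      r₀∉H : mem H r₀ ≡ false
      r₀∉H = trans (mem-⊕ʳ H q s₀ (∧-conicalʳ _ _ s₀∈T₁)) q∉H
      r₁∉H : mem H r₁ ≡ false
      r₁∉H = trans (mem-⊕ʳ H q′ s₁ (∧-conicalʳ _ _ s₁∈T₂)) q′∉H
      r₀∈Q : r₀ ∈ Q
      r₀∈Q = trans (mem-⊕ʳ Q q s₀ (E⊆Q s₀ (T₁⊆E s₀ s₀∈T₁))) q∈Q
      r₁∉Q : mem Q r₁ ≡ false
      r₁∉Q = trans (mem-⊕ʳ Q q′ s₁ (E⊆Q s₁ (T₂⊆E s₁ s₁∈T₂))) q′∉Q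

      r₀∈R : R r₀ ≡ true
      r₀∈R = R-intro r₀ r₀∉H
        (trans (mem-⊕ʳ (U i₁) q s₀ (∧-conicalˡ _ _ s₀∈T₁)) (U₃-outside-H-avoids i₁≢i₃ q q∈U₃ q∉H))
        (¬-not λ r₀∈U₂ → not-¬ (U₂-outside-H-avoids-Q r₀ r₀∈U₂ r₀∉H) r₀∈Q)
        (⊕-out-of-K∉U₃ q s₀ q∈U₃ (∧-conicalʳ _ _ s₀∈T₁) (T₁⊆E s₀ s₀∈T₁) s₀∉K)

      r₁∈R : R r₁ ≡ true
      r₁∈R = R-intro r₁ r₁∉H
        (¬-not λ r₁∈U₁ → not-¬ r₁∉Q (U₁⊆Q r₁ r₁∈U₁))
        (trans (mem-⊕ʳ (U i₂) q′ s₁ (∧-conicalˡ _ _ s₁∈T₂)) (U₃-outside-H-avoids i₂≢i₃ q′ q′∈U₃ q′∉H))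
        (⊕-out-of-K∉U₃ q′ s₁ q′∈U₃ (∧-conicalʳ _ _ s₁∈T₂) (T₂⊆E s₁ s₁∈T₂) s₁∉K)

      w : V (5 + m)
      w = r₀ ⊕ r₁

      w∉K : mem K w ≡ false
      w∉K = ¬-not λ w∈K → not-¬ (trans (mem-⊕ˡ Q r₀ r₁ r₀∈Q) r₁∉Q) (E⊆Q w (K⊆E w w∈K))

      K+w⊆H : (K +⟨ w ⟩) ⊆ H
      K+w⊆H = +⟨⟩-least K w H K⊆H (H-index r₀ r₁ r₀∉H r₁∉H)

      W : Subspace (5 + m)
      W = (K +⟨ w ⟩) +⟨ r₀ ⟩

      r₀∈W : r₀ ∈ W
      r₀∈W = +⟨⟩-new (K +⟨ w ⟩) r₀

      W≡ : count (mem W) ≡ 2 ^ (3 + m)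
      W≡ = count-+⟨⟩-2^ (2 + m) (K +⟨ w ⟩) r₀ (¬-not λ r₀∈ → not-¬ r₀∉H (K+w⊆H r₀ r₀∈))
             (count-+⟨⟩-2^ (1 + m) K w w∉K K≡)

      K+w-coset⊆R : ∀ p → (p ⊕ r₀) ∈ (K +⟨ w ⟩) → R p ≡ true
      K+w-coset⊆R p p⊕r₀∈K+w =
        [ R-⊕K r₀ p r₀∈R , (λ p⊕r₀⊕w∈K → R-⊕K r₁ p r₁∈R (subst (_∈ K) p⊕r₀⊕w≡p⊕r₁ p⊕r₀⊕w∈K)) ]′
          (+⟨⟩-elim K w (p ⊕ r₀) p⊕r₀∈K+w)
        where
        p⊕r₀⊕w≡p⊕r₁ : (p ⊕ r₀) ⊕ w ≡ p ⊕ r₁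
        p⊕r₀⊕w≡p⊕r₁ = trans (⊕-assoc p r₀ w) (cong (p ⊕_) (⊕-cancelˡ r₀ r₁))

      W-outside-H⊆R : ∀ p → p ∈ W → mem H p ≡ false → R p ≡ true
      W-outside-H⊆R p p∈W p∉H =
        [ (λ p∈K+w → ⊥-elim (not-¬ p∉H (K+w⊆H p p∈K+w))) , K+w-coset⊆R p ]′ (+⟨⟩-elim (K +⟨ w ⟩) r₀ p p∈W)

      R⊆W : ∀ p → R p ≡ true → p ∈ W
      R⊆W p p∈R = ∧-conicalˡ _ _ (count-≥⇒⊇ W∖H R W∖H⊆R (≤-reflexive (trans count-outside-three (sym W∖H≡))) p p∈R)
        where
        W∖H : Pred (5 + m)
        W∖H v = mem W v ∧ not (mem H v)
        W∖H⊆R : W∖H ⊆ᵇ R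
        W∖H⊆R v e = W-outside-H⊆R v (∧-conicalˡ _ _ e) (not-injective (∧-conicalʳ _ _ e))
        W∖H≡ : count W∖H ≡ 2 ^ (2 + m)
        W∖H≡ = trans (count-outside≡count-inside H H-index W r₀ r₀∈W r₀∉H)
                     (count-halves H H-index W r₀ r₀∈W r₀∉H (2 + m) W≡)

      S : Fin r → Bool
      S x = not (selects three x)

      S-outside-three : ∀ x → ¬ (x ∈ˡ three) → S x ≡ true
      S-outside-three x x∉ = cong not (dec-false (x ∈? three) x∉)

      S⇒outside-three : ∀ x → S x ≡ true → ¬ (x ∈ˡ three)
      S⇒outside-three x Sx x∈ = not-¬ (cong not (dec-true (x ∈? three) x∈)) Sx

      W-sub-avsp : IsSubAVSPOf S U W H
      W-sub-avsp = sub-avsp S W r₀ r₀∈W r₀∉H U⊆W selected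
        where
        selected : ∀ p → p ∈ W → mem H p ≡ false → ∀ x → p ∈ U x → S x ≡ true
        selected p p∈W p∉H x p∈Ux = S-outside-three x (outside-all⇒∉ three p (W-outside-H⊆R p p∈W p∉H) x p∈Ux)
        U⊆W : ∀ x → S x ≡ true → U x ⊆ W
        U⊆W x Sx = let (b , b∈U , b∉H) = point-outside x in
          outside-⊆⇒⊆ (U x) W H b b∈U b∉H λ y y∈U y∉H → R⊆W y (outside-all-intro three y y∉H x y∈U (S⇒outside-three x Sx))

      W⊆U : ∀ i → S i ≡ true → W ⊆ U i
      W⊆U = proper-sub-avsp⇒⊆ irreducible S W
        (3 + m , +-monoˡ-< m (s≤s (s≤s (s≤s (s≤s z≤n)))) , count⇒HasDim W (3 + m) W≡)
        (i₁ , cong not (dec-true (i₁ ∈? three) (here refl))) W-sub-avsp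

      K⊆U : ∀ i → Dec (i ∈ˡ three) → K ⊆ U i
      K⊆U i (yes i∈) κ κ∈K = K⊆U-three κ κ∈K i i∈
      K⊆U i (no i∉)  κ κ∈K = W⊆U i (S-outside-three i i∉) κ (+⟨⟩-base (K +⟨ w ⟩) r₀ κ (+⟨⟩-base K w κ κ∈K))

      impossible : ⊥
      impossible = <⇒≱ (subst (1 <_) (sym K≡) (*-monoʳ-≤ 2 (m^n>0 2 m)))
        (subst (count (mem K) ≤_) (count-isZero (5 + m))
          (count-mono (mem K) isZero λ κ κ∈K →
            subst (λ v → isZero v ≡ true) (sym (tight κ λ i → K⊆U i (i ∈? three) κ κ∈K)) (isZero-0V (5 + m))))

    impossible : ⊥
    impossible = [ A₃⊆Q-impossible , (λ (q′ , q′∈A₃ , q′∉Q) →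
      [ A₃∩Q-empty-impossible , (λ (q , q∈A₃ , q∈Q) →
        Straddling.impossible q q′ (∧-conicalˡ _ _ q∈A₃) (not-injective (∧-conicalʳ _ _ q∈A₃)) (not-injective q∈Q)
                                   (∧-conicalˡ _ _ q′∈A₃) (not-injective (∧-conicalʳ _ _ q′∈A₃)) q′∉Q) ]′
      (⊆ᵇ-or-witness A₃ (not ∘ mem Q))) ]′ (⊆ᵇ-or-witness A₃ (mem Q))

  impossible : ⊥
  impossible = let (E , E≡ , T₁⊆E , T₂⊆E , E⊆H , c∉E) = traces-span in TraceSum.impossible E E≡ T₁⊆E T₂⊆E E⊆H c∉E


distinct-triple : ∀ {A : Set} {P : A → Set} xs → Unique xs → All P xs → 3 ≤ length xs →
  Σ A λ x → Σ A λ y → Σ A λ z → ¬ (x ≡ y) × ¬ (x ≡ z) × ¬ (y ≡ z) × P x × P y × P z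
distinct-triple (x ∷ y ∷ z ∷ _) ((x≢y ∷ᵃ x≢z ∷ᵃ _) ∷ᵖ (y≢z ∷ᵃ _) ∷ᵖ _) (Px ∷ᵃ Py ∷ᵃ Pz ∷ᵃ _) _ =
  x , y , z , x≢y , x≢z , y≢z , Px , Py , Pz
distinct-triple []          _ _ ()
distinct-triple (_ ∷ [])     _ _ (s≤s ())
distinct-triple (_ ∷ _ ∷ []) _ _ (s≤s (s≤s ()))

mainTheorem19 : (n r : ℕ) → 5 ≤ n →
    (U : Fin r → Subspace n) → (H : Subspace n) →
    IsAVSP U H → Irreducible U H → Tight U →
    (d : Fin r → ℕ) → (∀ i → HasDim (U i) (d i)) →
    (∀ i → 2 ≤ d i × d i ≤ n ∸ 2) →
    mult d (n ∸ 2) ≤ 2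
mainTheorem19 .(5 + m) r (s≤s (s≤s (s≤s (s≤s (s≤s (z≤n {m}))))))
              U H (H-hyperplane , _ , U⊈H , partition) irreducible tight d dim _
  with 3 ≤? mult d (3 + m)
... | no  3≰mult = ≤-pred (≰⇒> 3≰mult)
... | yes 3≤mult =
  let dᵢ≟ = λ i → d i ≟ℕ (3 + m)
      (i₁ , i₂ , i₃ , i₁≢i₂ , i₁≢i₃ , i₂≢i₃ , d₁ , d₂ , d₃) =
        distinct-triple _ (filter⁺ dᵢ≟ (allFin⁺ r)) (all-filter dᵢ≟ (allFin r)) 3≤mult
      count-U : ∀ {i} → d i ≡ 3 + m → count (mem (U i)) ≡ 2 ^ (3 + m)
      count-U {i} dᵢ = HasDim⇒count (U i) (subst (HasDim (U i)) dᵢ (dim i))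
  in ⊥-elim (CodimTwoTriple.impossible m r U H (HasDim⇒count H H-hyperplane) U⊈H partition irreducible tight
               i₁≢i₂ i₁≢i₃ i₂≢i₃ (count-U d₁) (count-U d₂) (count-U d₃))
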